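{- Let $F$ be a finite field of order $q$ and $n\ge 1$. Then \[|(E_{11}+GL_n(F))\cap GL_n(F)| = (q^n-q^{n-1}-1)\prod_{k=1}^{n-1}(q^n-q^k).\]
   Context: $GL_n(F)$ is the group of invertible $n\times n$ matrices over $F$; $E_{11}$ is the $n\times n$ matrix with $1$ in position $(1,1)$ and $0$ elsewhere; $E_{11}+GL_n(F)=\{E_{11}+Y: Y\in GL_n(F)\}$. An empty product equals $1$. -}

module Defs where

open import Level using (Level; _⊔_)
open import Data.Nat using (ℕ)
open import Data.Fin using (Fin; zero; suc)
open import Data.Nat using (zero; suc)
open import Data.Product using (Σ; ∃; _×_; _,_; proj₁)
open import Relation.Nullary using (¬_)
open import Relation.Binary.Bundles using (Setoid)
import Relation.Binary.PropositionalEquality as ≡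
open import Function.Bundles using (Bijection)
open import Algebra.Bundles using (CommutativeRing)

private
  variable
    c ℓ : Level

IsField : CommutativeRing c ℓ → Set (c ⊔ ℓ)
IsField R = ¬ (1# ≈ 0#) × (∀ x → ¬ (x ≈ 0#) → ∃ λ y → x * y ≈ 1#)
  where open CommutativeRing R

HasCard : ∀ {a e} → Setoid a e → ℕ → Set (a ⊔ e)
HasCard A N = Bijection A (≡.setoid (Fin N))

HasOrder : CommutativeRing c ℓ → ℕ → Set (c ⊔ ℓ)
HasOrder R q = HasCard (CommutativeRing.setoid R) q

module MatrixDefs (R : CommutativeRing c ℓ) where
  open CommutativeRing R using (Carrier; _≈_; _+_; _*_; 0#; 1#; refl; sym; trans)

  sumFin : ∀ n → (Fin n → Carrier) → Carrier
  sumFin zero    f = 0#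
  sumFin (suc n) f = f zero + sumFin n (λ i → f (suc i))

  Mat : ℕ → Set c
  Mat n = Fin n → Fin n → Carrier

  _≈ₘ_ : ∀ {n} → Mat n → Mat n → Set ℓ
  A ≈ₘ B = ∀ i j → A i j ≈ B i j

  _+ₘ_ : ∀ {n} → Mat n → Mat n → Mat n
  (A +ₘ B) i j = A i j + B i j

  _*ₘ_ : ∀ {n} → Mat n → Mat n → Mat n
  _*ₘ_ {n} A B i j = sumFin n (λ k → A i k * B k j)

  δ : ∀ {n} → Fin n → Fin n → Carrier
  δ zero    zero    = 1#
  δ zero    (suc j) = 0#
  δ (suc i) zero    = 0#
  δ (suc i) (suc j) = δ i j

  Iₘ : ∀ {n} → Mat n
  Iₘ = δ

  E₁₁ : ∀ {n} → Mat n
  E₁₁ zero    zero    = 1#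
  E₁₁ zero    (suc j) = 0#
  E₁₁ (suc i) j       = 0#

  InGL : ∀ {n} → Mat n → Set (c ⊔ ℓ)
  InGL {n} A = Σ (Mat n) λ B → ((A *ₘ B) ≈ₘ Iₘ) × ((B *ₘ A) ≈ₘ Iₘ)

  InE₁₁+GL : ∀ {n} → Mat n → Set (c ⊔ ℓ)
  InE₁₁+GL {n} A = Σ (Mat n) λ Y → InGL Y × (A ≈ₘ (E₁₁ +ₘ Y))

  E₁₁+GL∩GL : ℕ → Setoid (c ⊔ ℓ) ℓ
  E₁₁+GL∩GL n = record
    { Carrier = Σ (Mat n) λ A → InE₁₁+GL A × InGL A
    ; _≈_ = λ x y → proj₁ x ≈ₘ proj₁ y
    ; isEquivalence = record
      { refl  = λ i j → refl
      ; sym   = λ p i j → sym (p i j)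
      ; trans = λ p q i j → trans (p i j) (q i j)
      }
    }

-- The map A ↦ A⁻¹ identifies (E₁₁ + GL_n) ∩ GL_n with the set of B ∈ GL_n with B₀₀ ≠ 1:
-- by the Sherman–Morrison formula, A − E₁₁ is invertible exactly when 1 − (A⁻¹)₀₀ is.
-- These B are counted by their first column. GL_n acts transitively on nonzero columns and
-- the matrices with first column e₀ are the [[1, w], [0, C]] with C ∈ GL_{n−1}, so each nonzero
-- column is the first column of exactly q^{n−1}·|GL_{n−1}| invertible matrices, and the
-- admissible columns are the (q − 1)q^{n−1} − 1 nonzero vectors with first entry ≠ 1. The same
-- fibration over all q^n − 1 nonzero columns gives |GL_n| = ∏_{k<n} (q^n − q^k), and then
-- q^{n−1}·|GL_{n−1}| = ∏_{k=1}^{n−1} (q^n − q^k).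

module Submission where

open import Level using (Level; _⊔_)
open import Data.Nat as ℕ using (ℕ; zero; suc; _^_; _∸_; _≥_)
open import Data.Nat.ListAction using (product)
open import Data.Fin as Fin using (Fin; zero; suc; punchIn; punchOut; combine; remQuot)
open import Data.Fin.Properties
  using (*↔×; punchOut-cong; punchOut-punchIn; punchIn-punchOut; punchInᵢ≢i; combine-remQuot; remQuot-combine; ¬∀⟶∃¬)
open import Data.Fin.Permutation using (Permutation; transpose; _⟨$⟩ʳ_; _⟨$⟩ˡ_; inverseˡ; flip)
open import Data.Product using (Σ; _×_; _,_; proj₁; proj₂)
open import Data.Product.Relation.Binary.Pointwise.NonDependent using (_×ₛ_; Pointwise-≡↔≡)
open import Data.Product.Function.NonDependent.Setoid using (_×-inverse_)
open import Data.Vec.Functional using (Vector)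
open import Function.Base using (_∘_)
open import Function.Bundles using (Func; Inverse; Injection)
open import Function.Definitions using (Congruent; StrictlyInverseˡ; StrictlyInverseʳ)
open import Function.Properties.Bijection using (Bijection⇒Inverse)
open import Function.Properties.Inverse using (Inverse⇒Injection; Inverse⇒Bijection)
import Function.Consequences.Setoid as Consequences
import Function.Construct.Composition as Compose
import Function.Construct.Symmetry as Symmetry
open import Algebra.Bundles using (CommutativeRing)
open import Relation.Binary.Bundles using (Setoid)
open import Relation.Binary.Definitions using (Decidable)
import Relation.Binary.Construct.On as On
open import Relation.Binary.PropositionalEquality as ≡ using (_≡_; _≢_)
import Relation.Binary.Reasoning.Setoid as SetoidReasoning
open import Relation.Nullary using (¬_)
import Relation.Nullary.Decidable as Dec
open import Defs

private
  variable
    a₁ a₂ p₁ p₂ ℓ₁ ℓ₂ : Level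

Card : Setoid a₁ ℓ₁ → ℕ → Set (a₁ ⊔ ℓ₁)
Card X N = Inverse X (≡.setoid (Fin N))

Sub : (X : Setoid a₁ ℓ₁) → (Setoid.Carrier X → Set p₁) → Setoid (a₁ ⊔ p₁) ℓ₁
Sub X P = On.setoid X (proj₁ {B = P})

module _ {X : Setoid a₁ ℓ₁} {Y : Setoid a₂ ℓ₂} where
  private
    module X = Setoid X
    module Y = Setoid Y

  mkInverse : (to : X.Carrier → Y.Carrier) (from : Y.Carrier → X.Carrier) →
              Congruent X._≈_ Y._≈_ to → Congruent Y._≈_ X._≈_ from →
              StrictlyInverseˡ Y._≈_ to from → StrictlyInverseʳ X._≈_ to from →
              Inverse X Y
  mkInverse to from to-cong from-cong invˡ invʳ = record
    { to = to ; from = from ; to-cong = to-cong ; from-cong = from-cong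
    ; inverse = strictlyInverseˡ⇒inverseˡ to-cong invˡ , strictlyInverseʳ⇒inverseʳ from-cong invʳ }
    where open Consequences X Y

card-↔ : {X : Setoid a₁ ℓ₁} {Y : Setoid a₂ ℓ₂} {N : ℕ} → Inverse X Y → Card Y N → Card X N
card-↔ = Compose.inverse

card-× : {X : Setoid a₁ ℓ₁} {Y : Setoid a₂ ℓ₂} {m n : ℕ} → Card X m → Card Y n → Card (X ×ₛ Y) (m ℕ.* n)
card-× CX CY = Compose.inverse (CX ×-inverse CY) (Compose.inverse Pointwise-≡↔≡ (Symmetry.inverse *↔×))

card⇒decidable : {X : Setoid a₁ ℓ₁} {N : ℕ} → Card X N → Decidable (Setoid._≈_ X)
card⇒decidable C x y = Dec.map′ (Injection.injective (Inverse⇒Injection C)) (Inverse.to-cong C) (Inverse.to C x Fin.≟ Inverse.to C y)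

card-remove : {X : Setoid a₁ ℓ₁} {N : ℕ} → Card X N → (x₀ : Setoid.Carrier X) →
              Card (Sub X (λ x → ¬ Setoid._≈_ X x x₀)) (N ∸ 1)
card-remove {N = zero} C x₀ with Inverse.to C x₀
... | ()
card-remove {X = X} {N = suc N} C x₀ = mkInverse to from (λ {x} {y} → to-cong {x} {y}) (λ { ≡.refl → refl }) to∘from from∘to
  where
  open Setoid X
  module C = Inverse C
  i₀ : Fin (suc N)
  i₀ = C.to x₀
  avoids : ∀ {x} → ¬ x ≈ x₀ → i₀ ≢ C.to x
  avoids x≉x₀ i₀≡ = x≉x₀ (Injection.injective (Inverse⇒Injection C) (≡.sym i₀≡))
  to : Σ Carrier (λ x → ¬ x ≈ x₀) → Fin N
  to (x , x≉x₀) = punchOut (avoids x≉x₀)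
  from : Fin N → Σ Carrier (λ x → ¬ x ≈ x₀)
  from i = C.from (punchIn i₀ i) , λ e → punchInᵢ≢i i₀ i (≡.trans (≡.sym (C.strictlyInverseˡ _)) (C.to-cong e))
  to-cong : ∀ {x y} → proj₁ x ≈ proj₁ y → to x ≡ to y
  to-cong {_ , _} {_ , _} e = punchOut-cong i₀ (C.to-cong e)
  to∘from : ∀ i → to (from i) ≡ i
  to∘from i = ≡.trans (punchOut-cong i₀ (C.strictlyInverseˡ _)) (punchOut-punchIn i₀)
  from∘to : ∀ x → proj₁ (from (to x)) ≈ proj₁ x
  from∘to (x , x≉x₀) = trans (C.from-cong (punchIn-punchOut _)) (C.strictlyInverseʳ x)

card-singleton : {X : Setoid a₁ ℓ₁} (x₀ : Setoid.Carrier X) → (∀ x → Setoid._≈_ X x x₀) → Card X 1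
card-singleton {X = X} x₀ all≈x₀ = mkInverse (λ _ → zero) (λ _ → x₀) (λ _ → ≡.refl) (λ _ → Setoid.refl X)
  (λ { zero → ≡.refl }) (λ x → Setoid.sym X (all≈x₀ x))

Sub-restrict : {X : Setoid a₁ ℓ₁} {P : Setoid.Carrier X → Set p₁} {Q : Setoid.Carrier X → Set p₂} →
               (∀ {x} → Q x → P x) → Inverse (Sub (Sub X P) (Q ∘ proj₁)) (Sub X Q)
Sub-restrict {X = X} Q⇒P = mkInverse (λ ((x , _) , qx) → x , qx) (λ (x , qx) → (x , Q⇒P qx) , qx)
  (λ e → e) (λ e → e) (λ _ → Setoid.refl X) (λ _ → Setoid.refl X)

module _ {X : Setoid a₁ ℓ₁} {Z : Setoid a₂ ℓ₂} (g : Func X Z) where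
  private
    module X = Setoid X
    module Z = Setoid Z
    module g = Func g

  Fibre : Z.Carrier → Setoid (a₁ ⊔ ℓ₂) ℓ₁
  Fibre z = Sub X (λ x → g.to x Z.≈ z)

  card-byConstantFibres : {K M : ℕ} → Card Z K → (∀ z → Card (Fibre z) M) → Card X (K ℕ.* M)
  card-byConstantFibres {K} {M} CZ CF = mkInverse to from to-cong (λ { ≡.refl → X.refl }) to∘from from∘to
    where
    module CZ = Inverse CZ
    module F i = Inverse (CF (CZ.from i))
    index : X.Carrier → Fin K
    index x = CZ.to (g.to x)
    inFibre : ∀ x → g.to x Z.≈ CZ.from (index x)
    inFibre x = Z.sym (CZ.strictlyInverseʳ (g.to x))
    to : X.Carrier → Fin (K ℕ.* M)
    to x = combine (index x) (F.to (index x) (x , inFibre x))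
    from : Fin (K ℕ.* M) → X.Carrier
    from k = proj₁ (F.from (proj₁ (remQuot {K} M k)) (proj₂ (remQuot {K} M k)))
    combine-cong : ∀ {i j} → i ≡ j → ∀ {x y e e′} → x X.≈ y → combine i (F.to i (x , e)) ≡ combine j (F.to j (y , e′))
    combine-cong {i} ≡.refl x≈y = ≡.cong (combine i) (F.to-cong i x≈y)
    to-cong : ∀ {x y} → x X.≈ y → to x ≡ to y
    to-cong x≈y = combine-cong (CZ.to-cong (g.cong x≈y)) x≈y
    to∘from : ∀ k → to (from k) ≡ k
    to∘from k = ≡.trans (combine-cong index≡i X.refl) (≡.trans (≡.cong (combine i) (F.strictlyInverseˡ i j)) (combine-remQuot {K} M k))
      where
      i : Fin K
      i = proj₁ (remQuot {K} M k)
      j : Fin M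
      j = proj₂ (remQuot {K} M k)
      index≡i : index (from k) ≡ i
      index≡i = ≡.trans (CZ.to-cong (proj₂ (F.from i j))) (CZ.strictlyInverseˡ i)
    from∘to : ∀ x → from (to x) X.≈ x
    from∘to x = fromPair (remQuot-combine {K} {M} (index x) _)
      where
      fromPair : ∀ {p} → p ≡ (index x , F.to (index x) (x , inFibre x)) → proj₁ (F.from (proj₁ p) (proj₂ p)) X.≈ x
      fromPair ≡.refl = F.strictlyInverseʳ (index x) (x , inFibre x)

module Arithmetic where

  open import Data.Nat using (_*_)
  open import Data.Nat.Properties using (*-distribˡ-∸; *-distribʳ-∸; *-identityˡ; *-commutativeSemigroup)
  open import Data.List using ([]; _∷_; map; upTo; applyUpTo; length)
  open import Data.List.Properties using (map-upTo; map-applyUpTo; length-upTo; map-cong)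
  open import Algebra.Properties.CommutativeSemigroup using (interchange)
  open import Relation.Binary.PropositionalEquality using (refl; sym; trans; cong; module ≡-Reasoning)
  open ≡-Reasoning

  glOrder : ℕ → ℕ → ℕ
  glOrder q n = product (map (λ k → q ^ n ∸ q ^ k) (upTo n))

  product-map-*ˡ : ∀ c (f : ℕ → ℕ) xs → product (map (λ x → c * f x) xs) ≡ c ^ length xs * product (map f xs)
  product-map-*ˡ c f [] = refl
  product-map-*ˡ c f (x ∷ xs) = begin
    c * f x * product (map (λ x → c * f x) xs)  ≡⟨ cong (c * f x *_) (product-map-*ˡ c f xs) ⟩
    c * f x * (c ^ length xs * product (map f xs)) ≡⟨ interchange *-commutativeSemigroup c (f x) _ _ ⟩
    c * c ^ length xs * (f x * product (map f xs)) ∎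

  product-powerDifferences : ∀ q m → product (map (λ k → q ^ suc m ∸ q ^ k) (applyUpTo suc m)) ≡ q ^ m * glOrder q m
  product-powerDifferences q m = begin
    product (map (λ k → q ^ suc m ∸ q ^ k) (applyUpTo suc m))
      ≡⟨ cong product (map-applyUpTo suc _ m) ⟩
    product (applyUpTo (λ k → q * q ^ m ∸ q * q ^ k) m)
      ≡⟨ cong product (sym (map-upTo _ m)) ⟩
    product (map (λ k → q * q ^ m ∸ q * q ^ k) (upTo m))
      ≡⟨ cong product (map-cong (λ k → sym (*-distribˡ-∸ q (q ^ m) (q ^ k))) (upTo m)) ⟩
    product (map (λ k → q * (q ^ m ∸ q ^ k)) (upTo m))
      ≡⟨ product-map-*ˡ q _ (upTo m) ⟩
    q ^ length (upTo m) * glOrder q m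
      ≡⟨ cong (λ l → q ^ l * glOrder q m) (length-upTo m) ⟩
    q ^ m * glOrder q m
      ∎

  glOrder-suc : ∀ q m → glOrder q (suc m) ≡ (q ^ suc m ∸ 1) * (q ^ m * glOrder q m)
  glOrder-suc q m = cong ((q ^ suc m ∸ 1) *_) (product-powerDifferences q m)

  [q∸1]*q^m≡q^[1+m]∸q^m : ∀ q m → (q ∸ 1) * q ^ m ≡ q ^ suc m ∸ q ^ m
  [q∸1]*q^m≡q^[1+m]∸q^m q m = trans (*-distribʳ-∸ (q ^ m) q 1) (cong (q ^ suc m ∸_) (*-identityˡ (q ^ m)))

open Arithmetic using (glOrder; product-powerDifferences; glOrder-suc; [q∸1]*q^m≡q^[1+m]∸q^m)

module Matrices {c ℓ} (R : CommutativeRing c ℓ) where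

  open CommutativeRing R hiding (zero)
  open MatrixDefs R
  open import Algebra.Solver.CommutativeMonoid *-commutativeMonoid using (solve; _⊕_; _⊜_)
  open import Algebra.Properties.Semiring.Sum semiring
    using (sum; sum-cong-≋; sum-cong-≗; sum-replicate-zero; ∑-distrib-+; ∑-comm; *-distribˡ-sum; *-distribʳ-sum)
  open import Algebra.Properties.AbelianGroup +-abelianGroup using (//-rightDividesˡ; xyx⁻¹≈y; x∙y⁻¹≈ε⇒x≈y)
  open import Algebra.Properties.Ring ring using (-1*x≈-x; -‿distribˡ-*; x[y-z]≈xy-xz; [y-z]x≈yx-zx)
  open import Data.Vec.Functional.Relation.Binary.Equality.Setoid setoid using (_≋_; ≋-setoid)

  sumFin≡sum : ∀ n (f : Vector Carrier n) → sumFin n f ≡ sum f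
  sumFin≡sum zero    f = ≡.refl
  sumFin≡sum (suc n) f = ≡.cong (f zero +_) (sumFin≡sum n (f ∘ suc))

  sumFin-cong : ∀ n {f g : Vector Carrier n} → (∀ i → f i ≈ g i) → sumFin n f ≈ sumFin n g
  sumFin-cong n {f} {g} f≈g rewrite sumFin≡sum n f | sumFin≡sum n g = sum-cong-≋ f≈g

  sumFin-zero : ∀ n {f : Vector Carrier n} → (∀ i → f i ≈ 0#) → sumFin n f ≈ 0#
  sumFin-zero n {f} f≈0 rewrite sumFin≡sum n f = trans (sum-cong-≋ f≈0) (sum-replicate-zero n)

  sumFin-distrib-+ : ∀ n (f g : Vector Carrier n) → sumFin n (λ i → f i + g i) ≈ sumFin n f + sumFin n g
  sumFin-distrib-+ n f g rewrite sumFin≡sum n (λ i → f i + g i) | sumFin≡sum n f | sumFin≡sum n g = ∑-distrib-+ f g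

  *-distribˡ-sumFin : ∀ n x (f : Vector Carrier n) → x * sumFin n f ≈ sumFin n (λ i → x * f i)
  *-distribˡ-sumFin n x f rewrite sumFin≡sum n f | sumFin≡sum n (λ i → x * f i) = *-distribˡ-sum x f

  *-distribʳ-sumFin : ∀ n x (f : Vector Carrier n) → sumFin n f * x ≈ sumFin n (λ i → f i * x)
  *-distribʳ-sumFin n x f rewrite sumFin≡sum n f | sumFin≡sum n (λ i → f i * x) = *-distribʳ-sum x f

  sumFin-comm : ∀ m n (f : Fin m → Fin n → Carrier) →
                sumFin m (λ i → sumFin n (f i)) ≈ sumFin n (λ j → sumFin m (λ i → f i j))
  sumFin-comm m n f = begin
    sumFin m (λ i → sumFin n (f i))          ≡⟨ sumFin≡sum m _ ⟩
    sum (λ i → sumFin n (f i))               ≡⟨ sum-cong-≗ (λ i → sumFin≡sum n (f i)) ⟩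
    sum (λ i → sum (f i))                    ≈⟨ ∑-comm f ⟩
    sum (λ j → sum (λ i → f i j))            ≡⟨ sum-cong-≗ (λ j → sumFin≡sum m (λ i → f i j)) ⟨
    sum (λ j → sumFin m (λ i → f i j))       ≡⟨ sumFin≡sum n _ ⟨
    sumFin n (λ j → sumFin m (λ i → f i j))  ∎
    where open SetoidReasoning setoid

  sumFin-δˡ : ∀ n i (f : Vector Carrier n) → sumFin n (λ k → δ i k * f k) ≈ f i
  sumFin-δˡ (suc n) zero    f = trans (+-cong (*-identityˡ (f zero)) (sumFin-zero n (λ k → zeroˡ (f (suc k))))) (+-identityʳ _)
  sumFin-δˡ (suc n) (suc i) f = trans (+-cong (zeroˡ (f zero)) (sumFin-δˡ n i (f ∘ suc))) (+-identityˡ _)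

  δ-comm : ∀ {n} (i j : Fin n) → δ i j ≡ δ j i
  δ-comm zero    zero    = ≡.refl
  δ-comm zero    (suc j) = ≡.refl
  δ-comm (suc i) zero    = ≡.refl
  δ-comm (suc i) (suc j) = δ-comm i j

  sumFin-δʳ : ∀ n j (f : Vector Carrier n) → sumFin n (λ k → f k * δ k j) ≈ f j
  sumFin-δʳ n j f = trans (sumFin-cong n (λ k → trans (*-comm (f k) _) (*-congʳ (reflexive (δ-comm k j))))) (sumFin-δˡ n j f)

  -‿sumFin : ∀ n (f : Vector Carrier n) → - sumFin n f ≈ sumFin n (λ i → - f i)
  -‿sumFin n f = begin
    - sumFin n f                       ≈⟨ -1*x≈-x _ ⟨
    - 1# * sumFin n f                  ≈⟨ *-distribˡ-sumFin n (- 1#) f ⟩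
    sumFin n (λ i → - 1# * f i)        ≈⟨ sumFin-cong n (λ i → -1*x≈-x (f i)) ⟩
    sumFin n (λ i → - f i)             ∎
    where open SetoidReasoning setoid

  matrixSetoid : ℕ → Setoid c ℓ
  matrixSetoid n = record
    { Carrier = Mat n
    ; _≈_ = _≈ₘ_
    ; isEquivalence = record
      { refl = λ i j → refl ; sym = λ p i j → sym (p i j) ; trans = λ p q i j → trans (p i j) (q i j) } }

  module ≈ₘ {n : ℕ} = Setoid (matrixSetoid n)

  0ᵥ : ∀ {n} → Vector Carrier n
  0ᵥ _ = 0#

  _ᵥ*ₘ_ : ∀ {n} → Vector Carrier n → Mat n → Vector Carrier n
  _ᵥ*ₘ_ {n} x A j = sumFin n (λ k → x k * A k j)

  ᵥ*ₘ-assoc : ∀ {n} (x : Vector Carrier n) (A B : Mat n) j → ((x ᵥ*ₘ A) ᵥ*ₘ B) j ≈ (x ᵥ*ₘ (A *ₘ B)) j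
  ᵥ*ₘ-assoc {n} x A B j = begin
    sumFin n (λ k → sumFin n (λ l → x l * A l k) * B k j)  ≈⟨ sumFin-cong n (λ k → *-distribʳ-sumFin n (B k j) _) ⟩
    sumFin n (λ k → sumFin n (λ l → x l * A l k * B k j))  ≈⟨ sumFin-comm n n _ ⟩
    sumFin n (λ l → sumFin n (λ k → x l * A l k * B k j))  ≈⟨ sumFin-cong n (λ l → sumFin-cong n (λ k → *-assoc _ _ _)) ⟩
    sumFin n (λ l → sumFin n (λ k → x l * (A l k * B k j))) ≈⟨ sumFin-cong n (λ l → *-distribˡ-sumFin n (x l) _) ⟨
    sumFin n (λ l → x l * sumFin n (λ k → A l k * B k j))  ∎
    where open SetoidReasoning setoid

  ᵥ*ₘ-cong : ∀ {n} {x y : Vector Carrier n} {A B : Mat n} → x ≋ y → A ≈ₘ B → (x ᵥ*ₘ A) ≋ (y ᵥ*ₘ B)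
  ᵥ*ₘ-cong {n} x≋y A≈B j = sumFin-cong n (λ k → *-cong (x≋y k) (A≈B k j))

  ᵥ*ₘ-identityʳ : ∀ {n} (x : Vector Carrier n) → (x ᵥ*ₘ Iₘ) ≋ x
  ᵥ*ₘ-identityʳ {n} x j = sumFin-δʳ n j x

  -‿ᵥ*ₘ : ∀ {n} (x : Vector Carrier n) (A : Mat n) j → ((λ k → - x k) ᵥ*ₘ A) j ≈ - (x ᵥ*ₘ A) j
  -‿ᵥ*ₘ {n} x A j = sym (trans (-‿sumFin n _) (sumFin-cong n (λ k → -‿distribˡ-* (x k) (A k j))))

  _*ₘᵥ_ : ∀ {n} → Mat n → Vector Carrier n → Vector Carrier n
  _*ₘᵥ_ {n} A x i = sumFin n (λ k → A i k * x k)

  *ₘᵥ-congʳ : ∀ {n} (A : Mat n) {x y : Vector Carrier n} → x ≋ y → (A *ₘᵥ x) ≋ (A *ₘᵥ y)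
  *ₘᵥ-congʳ {n} A x≋y i = sumFin-cong n (λ k → *-congˡ (x≋y k))

  *ₘᵥ-zeroʳ : ∀ {n} (A : Mat n) {x : Vector Carrier n} → x ≋ 0ᵥ → (A *ₘᵥ x) ≋ 0ᵥ
  *ₘᵥ-zeroʳ {n} A x≋0 i = trans (*ₘᵥ-congʳ A x≋0 i) (sumFin-zero n (λ k → zeroʳ (A i k)))

  *ₘ-cong : ∀ {n} {A A′ B B′ : Mat n} → A ≈ₘ A′ → B ≈ₘ B′ → (A *ₘ B) ≈ₘ (A′ *ₘ B′)
  *ₘ-cong {n} A≈A′ B≈B′ i j = sumFin-cong n (λ k → *-cong (A≈A′ i k) (B≈B′ k j))

  *ₘ-assoc : ∀ {n} (A B C : Mat n) → ((A *ₘ B) *ₘ C) ≈ₘ (A *ₘ (B *ₘ C))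
  *ₘ-assoc A B C i = ᵥ*ₘ-assoc (A i) B C

  *ₘ-identityˡ : ∀ {n} (A : Mat n) → (Iₘ *ₘ A) ≈ₘ A
  *ₘ-identityˡ {n} A i j = sumFin-δˡ n i (λ k → A k j)

  *ₘ-identityʳ : ∀ {n} (A : Mat n) → (A *ₘ Iₘ) ≈ₘ A
  *ₘ-identityʳ {n} A i j = sumFin-δʳ n j (A i)

  *ₘ-cancelˡ : ∀ {n} {X Y : Mat n} (C : Mat n) → (X *ₘ Y) ≈ₘ Iₘ → (X *ₘ (Y *ₘ C)) ≈ₘ C
  *ₘ-cancelˡ {X = X} {Y} C XY≈I = begin
    X *ₘ (Y *ₘ C)  ≈⟨ *ₘ-assoc X Y C ⟨
    (X *ₘ Y) *ₘ C  ≈⟨ *ₘ-cong XY≈I ≈ₘ.refl ⟩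
    Iₘ *ₘ C        ≈⟨ *ₘ-identityˡ C ⟩
    C              ∎
    where open SetoidReasoning (matrixSetoid _)

  *ₘ-cancelInner : ∀ {n} (A X Y C : Mat n) → (X *ₘ Y) ≈ₘ Iₘ → ((A *ₘ X) *ₘ (Y *ₘ C)) ≈ₘ (A *ₘ C)
  *ₘ-cancelInner A X Y C XY≈I = ≈ₘ.trans (*ₘ-assoc A X (Y *ₘ C)) (*ₘ-cong {A = A} ≈ₘ.refl (*ₘ-cancelˡ C XY≈I))

  InGL-*ₘ : ∀ {n} (A B : Mat n) → InGL A → InGL B → InGL (A *ₘ B)
  InGL-*ₘ A B (A′ , AA′ , A′A) (B′ , BB′ , B′B) =
    B′ *ₘ A′ , ≈ₘ.trans (*ₘ-cancelInner A B B′ A′ BB′) AA′ , ≈ₘ.trans (*ₘ-cancelInner B′ A′ A B A′A) B′B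

  inverse-unique : ∀ {n} (A B B′ : Mat n) → (B′ *ₘ A) ≈ₘ Iₘ → (A *ₘ B) ≈ₘ Iₘ → B′ ≈ₘ B
  inverse-unique A B B′ B′A≈I AB≈I = begin
    B′              ≈⟨ *ₘ-identityʳ B′ ⟨
    B′ *ₘ Iₘ        ≈⟨ *ₘ-cong {A = B′} ≈ₘ.refl AB≈I ⟨
    B′ *ₘ (A *ₘ B)  ≈⟨ *ₘ-assoc B′ A B ⟨
    (B′ *ₘ A) *ₘ B  ≈⟨ *ₘ-cong B′A≈I ≈ₘ.refl ⟩
    Iₘ *ₘ B         ≈⟨ *ₘ-identityˡ B ⟩
    B               ∎
    where open SetoidReasoning (matrixSetoid _)

  InGL-resp-≈ₘ : ∀ {n} {A A′ : Mat n} → A ≈ₘ A′ → InGL A → InGL A′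
  InGL-resp-≈ₘ {A = A} {A′} A≈A′ (B , AB≈I , BA≈I) =
    B , ≈ₘ.trans (*ₘ-cong (≈ₘ.sym A≈A′) ≈ₘ.refl) AB≈I , ≈ₘ.trans (*ₘ-cong {A = B} ≈ₘ.refl (≈ₘ.sym A≈A′)) BA≈I

  inverse-cong : ∀ {n} (A A′ B B′ : Mat n) → (B *ₘ A) ≈ₘ Iₘ → (A′ *ₘ B′) ≈ₘ Iₘ → A ≈ₘ A′ → B ≈ₘ B′
  inverse-cong A A′ B B′ BA≈I A′B′≈I A≈A′ =
    inverse-unique A′ B′ B (≈ₘ.trans (*ₘ-cong {A = B} ≈ₘ.refl (≈ₘ.sym A≈A′)) BA≈I) A′B′≈I

  permutationMatrix : ∀ {n} → Permutation n n → Mat n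
  permutationMatrix π i j = δ (π ⟨$⟩ʳ i) j

  permutationMatrix-*ₘ : ∀ {n} (π : Permutation n n) (A : Mat n) i j → (permutationMatrix π *ₘ A) i j ≈ A (π ⟨$⟩ʳ i) j
  permutationMatrix-*ₘ {n} π A i j = sumFin-δˡ n (π ⟨$⟩ʳ i) (λ k → A k j)

  permutationMatrix-InGL : ∀ {n} (π : Permutation n n) → InGL (permutationMatrix π)
  permutationMatrix-InGL π = permutationMatrix (flip π) , undo π , undo (flip π)
    where
    undo : ∀ {n} (σ : Permutation n n) → (permutationMatrix σ *ₘ permutationMatrix (flip σ)) ≈ₘ Iₘ
    undo σ i j = trans (permutationMatrix-*ₘ σ (permutationMatrix (flip σ)) i j) (reflexive (≡.cong (λ k → δ k j) (inverseˡ σ {i})))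

  firstColumn : ∀ {m} → Mat (suc m) → Vector Carrier (suc m)
  firstColumn A i = A i zero

  e₀ : ∀ {m} → Vector Carrier (suc m)
  e₀ = firstColumn Iₘ

  InGL⇒firstColumn≉0 : ¬ 1# ≈ 0# → ∀ {m} (A : Mat (suc m)) → InGL A → ¬ firstColumn A ≋ 0ᵥ
  InGL⇒firstColumn≉0 1≉0 A (A′ , _ , A′A≈I) column≋0 = 1≉0 (trans (sym (A′A≈I zero zero)) (*ₘᵥ-zeroʳ A′ column≋0 zero))

  withFirstColumn : ∀ {m} → Vector Carrier (suc m) → Mat (suc m)
  withFirstColumn u i       zero    = u i
  withFirstColumn u zero    (suc j) = 0#
  withFirstColumn u (suc i) (suc j) = δ i j

  withFirstColumn-*ₘ-zero : ∀ {m} (u : Vector Carrier (suc m)) (X : Mat (suc m)) j →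
                            (withFirstColumn u *ₘ X) zero j ≈ u zero * X zero j
  withFirstColumn-*ₘ-zero {m} u X j = trans (+-congˡ (sumFin-zero m (λ k → zeroˡ _))) (+-identityʳ _)

  withFirstColumn-*ₘ-suc : ∀ {m} (u : Vector Carrier (suc m)) (X : Mat (suc m)) i j →
                           (withFirstColumn u *ₘ X) (suc i) j ≈ u (suc i) * X zero j + X (suc i) j
  withFirstColumn-*ₘ-suc {m} u X i j = +-congˡ (sumFin-δˡ m i (λ k → X (suc k) j))

  withFirstColumn-InGL : ∀ {m} (u : Vector Carrier (suc m)) {a} → u zero * a ≈ 1# → InGL (withFirstColumn u)
  withFirstColumn-InGL u {a} u₀a≈1 = withFirstColumn u⁻¹ , WW⁻¹≈I , W⁻¹W≈I
    where
    u⁻¹ : Vector Carrier _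
    u⁻¹ zero    = a
    u⁻¹ (suc i) = - (u (suc i) * a)
    WW⁻¹≈I : (withFirstColumn u *ₘ withFirstColumn u⁻¹) ≈ₘ Iₘ
    WW⁻¹≈I zero    zero    = trans (withFirstColumn-*ₘ-zero u (withFirstColumn u⁻¹) zero) u₀a≈1
    WW⁻¹≈I zero    (suc j) = trans (withFirstColumn-*ₘ-zero u (withFirstColumn u⁻¹) (suc j)) (zeroʳ _)
    WW⁻¹≈I (suc i) zero    = trans (withFirstColumn-*ₘ-suc u (withFirstColumn u⁻¹) i zero) (-‿inverseʳ _)
    WW⁻¹≈I (suc i) (suc j) = trans (withFirstColumn-*ₘ-suc u (withFirstColumn u⁻¹) i (suc j)) (trans (+-congʳ (zeroʳ _)) (+-identityˡ _))
    W⁻¹W≈I : (withFirstColumn u⁻¹ *ₘ withFirstColumn u) ≈ₘ Iₘ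
    W⁻¹W≈I zero    zero    = trans (withFirstColumn-*ₘ-zero u⁻¹ (withFirstColumn u) zero) (trans (*-comm a _) u₀a≈1)
    W⁻¹W≈I zero    (suc j) = trans (withFirstColumn-*ₘ-zero u⁻¹ (withFirstColumn u) (suc j)) (zeroʳ _)
    W⁻¹W≈I (suc i) zero    = trans (withFirstColumn-*ₘ-suc u⁻¹ (withFirstColumn u) i zero) (trans (+-congʳ cancel) (-‿inverseˡ _))
      where
      cancel : - (u (suc i) * a) * u zero ≈ - u (suc i)
      cancel = begin
        - (u (suc i) * a) * u zero  ≈⟨ -‿distribˡ-* _ _ ⟨
        - (u (suc i) * a * u zero)  ≈⟨ -‿cong (*-assoc _ _ _) ⟩
        - (u (suc i) * (a * u zero)) ≈⟨ -‿cong (*-congˡ (trans (*-comm a _) u₀a≈1)) ⟩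
        - (u (suc i) * 1#)          ≈⟨ -‿cong (*-identityʳ _) ⟩
        - u (suc i)                 ∎
        where open SetoidReasoning setoid
    W⁻¹W≈I (suc i) (suc j) = trans (withFirstColumn-*ₘ-suc u⁻¹ (withFirstColumn u) i (suc j)) (trans (+-congʳ (zeroʳ _)) (+-identityˡ _))

  affine : ∀ {m} → Vector Carrier m → Mat m → Mat (suc m)
  affine w B zero    zero    = 1#
  affine w B zero    (suc j) = w j
  affine w B (suc i) zero    = 0#
  affine w B (suc i) (suc j) = B i j

  affine-cong : ∀ {m} {w w′ : Vector Carrier m} {B B′ : Mat m} → w ≋ w′ → B ≈ₘ B′ → affine w B ≈ₘ affine w′ B′
  affine-cong w≋w′ B≈B′ zero    zero    = refl
  affine-cong w≋w′ B≈B′ zero    (suc j) = w≋w′ j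
  affine-cong w≋w′ B≈B′ (suc i) zero    = refl
  affine-cong w≋w′ B≈B′ (suc i) (suc j) = B≈B′ i j

  affine-identity : ∀ {m} → affine {m} 0ᵥ Iₘ ≈ₘ Iₘ
  affine-identity zero    zero    = refl
  affine-identity zero    (suc j) = refl
  affine-identity (suc i) zero    = refl
  affine-identity (suc i) (suc j) = refl

  affine-*ₘ : ∀ {m} (w w′ : Vector Carrier m) (B B′ : Mat m) →
              (affine w B *ₘ affine w′ B′) ≈ₘ affine (λ j → w′ j + (w ᵥ*ₘ B′) j) (B *ₘ B′)
  affine-*ₘ {m} w w′ B B′ zero    zero    = trans (+-congˡ (sumFin-zero m (λ k → zeroʳ _))) (trans (+-identityʳ _) (*-identityˡ 1#))
  affine-*ₘ {m} w w′ B B′ zero    (suc j) = +-congʳ (*-identityˡ _)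
  affine-*ₘ {m} w w′ B B′ (suc i) zero    = trans (+-congˡ (sumFin-zero m (λ k → zeroʳ _))) (trans (+-identityʳ _) (zeroˡ 1#))
  affine-*ₘ {m} w w′ B B′ (suc i) (suc j) = trans (+-congʳ (zeroˡ _)) (+-identityˡ _)

  affine-InGL : ∀ {m} (w : Vector Carrier m) {B : Mat m} → InGL B → InGL (affine w B)
  affine-InGL w {B} (B⁻¹ , BB⁻¹≈I , B⁻¹B≈I) = affine v B⁻¹ , AA⁻¹≈I , A⁻¹A≈I
    where
    v : Vector Carrier _
    v k = - (w ᵥ*ₘ B⁻¹) k
    AA⁻¹≈I : (affine w B *ₘ affine v B⁻¹) ≈ₘ Iₘ
    AA⁻¹≈I = ≈ₘ.trans (affine-*ₘ w v B B⁻¹) (≈ₘ.trans (affine-cong (λ j → -‿inverseˡ _) BB⁻¹≈I) affine-identity)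
    vB≋-w : ∀ j → (v ᵥ*ₘ B) j ≈ - w j
    vB≋-w j = begin
      (v ᵥ*ₘ B) j                   ≈⟨ -‿ᵥ*ₘ (w ᵥ*ₘ B⁻¹) B j ⟩
      - ((w ᵥ*ₘ B⁻¹) ᵥ*ₘ B) j        ≈⟨ -‿cong (ᵥ*ₘ-assoc w B⁻¹ B j) ⟩
      - (w ᵥ*ₘ (B⁻¹ *ₘ B)) j         ≈⟨ -‿cong (ᵥ*ₘ-cong (λ k → refl) B⁻¹B≈I j) ⟩
      - (w ᵥ*ₘ Iₘ) j                 ≈⟨ -‿cong (ᵥ*ₘ-identityʳ w j) ⟩
      - w j                          ∎
      where open SetoidReasoning setoid
    A⁻¹A≈I : (affine v B⁻¹ *ₘ affine w B) ≈ₘ Iₘ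
    A⁻¹A≈I = ≈ₘ.trans (affine-*ₘ v w B⁻¹ B)
      (≈ₘ.trans (affine-cong (λ j → trans (+-congˡ (vB≋-w j)) (-‿inverseʳ _)) B⁻¹B≈I) affine-identity)

  lowerRight : ∀ {m} → Mat (suc m) → Mat m
  lowerRight A i j = A (suc i) (suc j)

  lowerRight-*ₘ : ∀ {m} (A B : Mat (suc m)) → firstColumn A ≋ e₀ →
                  lowerRight (A *ₘ B) ≈ₘ (lowerRight A *ₘ lowerRight B)
  lowerRight-*ₘ A B column≋e₀ i j = trans (+-congʳ (trans (*-congʳ (column≋e₀ (suc i))) (zeroˡ _))) (+-identityˡ _)

  firstColumn-leftInverse : ∀ {n} {A B : Mat (suc n)} → (A *ₘ B) ≈ₘ Iₘ → firstColumn B ≋ e₀ → firstColumn A ≋ e₀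
  firstColumn-leftInverse {n} {A} {B} AB≈I column≋e₀ i = begin
    A i zero                 ≈⟨ sumFin-δʳ (suc n) zero (A i) ⟨
    (A *ₘᵥ e₀) i             ≈⟨ *ₘᵥ-congʳ A column≋e₀ i ⟨
    (A *ₘ B) i zero          ≈⟨ AB≈I i zero ⟩
    e₀ i                     ∎
    where open SetoidReasoning setoid

  lowerRight-InGL : ∀ {m} (A : Mat (suc m)) → InGL A → firstColumn A ≋ e₀ → InGL (lowerRight A)
  lowerRight-InGL A (A⁻¹ , AA⁻¹≈I , A⁻¹A≈I) column≋e₀ = lowerRight A⁻¹ ,
    ≈ₘ.trans (≈ₘ.sym (lowerRight-*ₘ A A⁻¹ column≋e₀)) (λ i j → AA⁻¹≈I (suc i) (suc j)) ,
    ≈ₘ.trans (≈ₘ.sym (lowerRight-*ₘ A⁻¹ A (firstColumn-leftInverse {A = A⁻¹} {B = A} A⁻¹A≈I column≋e₀)))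
             (λ i j → A⁻¹A≈I (suc i) (suc j))

  GL : ℕ → Setoid (c ⊔ ℓ) ℓ
  GL n = Sub (matrixSetoid n) InGL

  GLwithFirstColumn : ∀ {m} → Vector Carrier (suc m) → Setoid (c ⊔ ℓ) ℓ
  GLwithFirstColumn v = Sub (GL _) (λ A → firstColumn (proj₁ A) ≋ v)

  GLwithFirstColumn-e₀↔ : ∀ {m} → Inverse (GLwithFirstColumn {m} e₀) (≋-setoid m ×ₛ GL m)
  GLwithFirstColumn-e₀↔ {m} = mkInverse to from
    (λ A≈B → (λ j → A≈B zero (suc j)) , (λ i j → A≈B (suc i) (suc j)))
    (λ (w≋w′ , B≈B′) → affine-cong w≋w′ B≈B′)
    (λ _ → (λ j → refl) , (λ i j → refl))
    from∘to
    where
    to : Setoid.Carrier (GLwithFirstColumn e₀) → Setoid.Carrier (≋-setoid m ×ₛ GL m)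
    to ((A , A-InGL) , column≋e₀) = (λ j → A zero (suc j)) , lowerRight A , lowerRight-InGL A A-InGL column≋e₀
    from : Setoid.Carrier (≋-setoid m ×ₛ GL m) → Setoid.Carrier (GLwithFirstColumn e₀)
    from (w , B , B-InGL) = (affine w B , affine-InGL w B-InGL) , λ { zero → refl ; (suc i) → refl }
    from∘to : ∀ A → proj₁ (proj₁ (from (to A))) ≈ₘ proj₁ (proj₁ A)
    from∘to ((A , _) , column≋e₀) zero    zero    = sym (column≋e₀ zero)
    from∘to ((A , _) , column≋e₀) zero    (suc j) = refl
    from∘to ((A , _) , column≋e₀) (suc i) zero    = sym (column≋e₀ (suc i))
    from∘to ((A , _) , column≋e₀) (suc i) (suc j) = refl

  GLwithFirstColumn-translate : ∀ {m} {v : Vector Carrier (suc m)} {P : Mat (suc m)} → InGL P → firstColumn P ≋ v →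
                                Inverse (GLwithFirstColumn v) (GLwithFirstColumn e₀)
  GLwithFirstColumn-translate {m} {v} {P} P-InGL@(P⁻¹ , PP⁻¹≈I , P⁻¹P≈I) P-column≋v = mkInverse to from
    (*ₘ-cong {A = P⁻¹} ≈ₘ.refl) (*ₘ-cong {A = P} ≈ₘ.refl)
    (λ ((B , _) , _) → *ₘ-cancelˡ {X = P⁻¹} {Y = P} B P⁻¹P≈I) (λ ((A , _) , _) → *ₘ-cancelˡ {X = P} {Y = P⁻¹} A PP⁻¹≈I)
    where
    P⁻¹-InGL : InGL P⁻¹
    P⁻¹-InGL = P , P⁻¹P≈I , PP⁻¹≈I
    to : Setoid.Carrier (GLwithFirstColumn v) → Setoid.Carrier (GLwithFirstColumn e₀)
    to ((A , A-InGL) , column≋v) = (P⁻¹ *ₘ A , InGL-*ₘ P⁻¹ A P⁻¹-InGL A-InGL) , λ i → begin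
      (P⁻¹ *ₘᵥ firstColumn A) i  ≈⟨ *ₘᵥ-congʳ P⁻¹ (λ k → trans (column≋v k) (sym (P-column≋v k))) i ⟩
      (P⁻¹ *ₘ P) i zero          ≈⟨ P⁻¹P≈I i zero ⟩
      e₀ i                       ∎
      where open SetoidReasoning setoid
    from : Setoid.Carrier (GLwithFirstColumn e₀) → Setoid.Carrier (GLwithFirstColumn v)
    from ((B , B-InGL) , column≋e₀) = (P *ₘ B , InGL-*ₘ P B P-InGL B-InGL) , λ i → begin
      (P *ₘᵥ firstColumn B) i  ≈⟨ *ₘᵥ-congʳ P column≋e₀ i ⟩
      (P *ₘᵥ e₀) i             ≈⟨ sumFin-δʳ (suc m) zero (P i) ⟩
      P i zero                 ≈⟨ P-column≋v i ⟩
      v i                      ∎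
      where open SetoidReasoning setoid

  _-ₘ_ : ∀ {n} → Mat n → Mat n → Mat n
  (A -ₘ B) i j = A i j - B i j

  *ₘ-distribʳ-‿ : ∀ {n} (A B C : Mat n) → ((A -ₘ B) *ₘ C) ≈ₘ ((A *ₘ C) -ₘ (B *ₘ C))
  *ₘ-distribʳ-‿ {n} A B C i j = begin
    sumFin n (λ k → (A i k - B i k) * C k j)                    ≈⟨ sumFin-cong n (λ k → [y-z]x≈yx-zx (C k j) (A i k) (B i k)) ⟩
    sumFin n (λ k → A i k * C k j + - (B i k * C k j))         ≈⟨ sumFin-distrib-+ n _ _ ⟩
    (A *ₘ C) i j + sumFin n (λ k → - (B i k * C k j))           ≈⟨ +-congˡ (-‿sumFin n _) ⟨
    (A *ₘ C) i j - (B *ₘ C) i j                                 ∎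
    where open SetoidReasoning setoid

  *ₘ-distribˡ-‿ : ∀ {n} (C A B : Mat n) → (C *ₘ (A -ₘ B)) ≈ₘ ((C *ₘ A) -ₘ (C *ₘ B))
  *ₘ-distribˡ-‿ {n} C A B i j = begin
    sumFin n (λ k → C i k * (A k j - B k j))                    ≈⟨ sumFin-cong n (λ k → x[y-z]≈xy-xz (C i k) (A k j) (B k j)) ⟩
    sumFin n (λ k → C i k * A k j + - (C i k * B k j))         ≈⟨ sumFin-distrib-+ n _ _ ⟩
    (C *ₘ A) i j + sumFin n (λ k → - (C i k * B k j))           ≈⟨ +-congˡ (-‿sumFin n _) ⟨
    (C *ₘ A) i j - (C *ₘ B) i j                                 ∎
    where open SetoidReasoning setoid

  E₁₁-*ₘ : ∀ {m} (B : Mat (suc m)) i j → (E₁₁ *ₘ B) i j ≈ e₀ i * B zero j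
  E₁₁-*ₘ {m} B zero    j = trans (+-congˡ (sumFin-zero m (λ k → zeroˡ _))) (+-identityʳ _)
  E₁₁-*ₘ {m} B (suc i) j = trans (+-congˡ (sumFin-zero m (λ k → zeroˡ _))) (+-identityʳ _)

  *ₘ-E₁₁ : ∀ {m} (B : Mat (suc m)) i j → (B *ₘ E₁₁) i j ≈ B i zero * e₀ j
  *ₘ-E₁₁ {m} B i zero    = trans (+-congˡ (sumFin-zero m (λ k → zeroʳ _))) (+-identityʳ _)
  *ₘ-E₁₁ {m} B i (suc j) = trans (+-congˡ (sumFin-zero m (λ k → zeroʳ _))) (+-identityʳ _)

  -- B + c·(Be₀)(e₀ᵀB): for B = A⁻¹ and c = (1 − B₀₀)⁻¹ this is the Sherman–Morrison inverse of A − E₁₁.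
  shermanMorrison : ∀ {m} → Mat (suc m) → Carrier → Mat (suc m)
  shermanMorrison B c i j = B i j + c * (B i zero * B zero j)

  *ₘ-shermanMorrison : ∀ {m} (X B : Mat (suc m)) c i j →
                       (X *ₘ shermanMorrison B c) i j ≈ (X *ₘ B) i j + c * ((X *ₘ B) i zero * B zero j)
  *ₘ-shermanMorrison {m} X B c i j = begin
    sumFin n (λ k → X i k * (B k j + c * (B k zero * B zero j)))
      ≈⟨ sumFin-cong n (λ k → trans (distribˡ (X i k) (B k j) _) (+-congˡ (rearrange (X i k) (B k zero)))) ⟩
    sumFin n (λ k → X i k * B k j + c * (X i k * B k zero * B zero j))
      ≈⟨ sumFin-distrib-+ n (λ k → X i k * B k j) (λ k → c * (X i k * B k zero * B zero j)) ⟩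
    (X *ₘ B) i j + sumFin n (λ k → c * (X i k * B k zero * B zero j))
      ≈⟨ +-congˡ (*-distribˡ-sumFin n c (λ k → X i k * B k zero * B zero j)) ⟨
    (X *ₘ B) i j + c * sumFin n (λ k → X i k * B k zero * B zero j)
      ≈⟨ +-congˡ (*-congˡ (*-distribʳ-sumFin n (B zero j) (λ k → X i k * B k zero))) ⟨
    (X *ₘ B) i j + c * ((X *ₘ B) i zero * B zero j)
      ∎
    where
    open SetoidReasoning setoid
    n : ℕ
    n = suc m
    rearrange : ∀ x y → x * (c * (y * B zero j)) ≈ c * (x * y * B zero j)
    rearrange x y = solve 4 (λ x c y b → x ⊕ (c ⊕ (y ⊕ b)) ⊜ c ⊕ ((x ⊕ y) ⊕ b)) refl x c y (B zero j)

  shermanMorrison-*ₘ : ∀ {m} (B X : Mat (suc m)) c i j →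
                       (shermanMorrison B c *ₘ X) i j ≈ (B *ₘ X) i j + c * (B i zero * (B *ₘ X) zero j)
  shermanMorrison-*ₘ {m} B X c i j = begin
    sumFin n (λ k → (B i k + c * (B i zero * B zero k)) * X k j)
      ≈⟨ sumFin-cong n (λ k → trans (distribʳ (X k j) (B i k) _) (+-congˡ (rearrange (B zero k) (X k j)))) ⟩
    sumFin n (λ k → B i k * X k j + c * (B i zero * (B zero k * X k j)))
      ≈⟨ sumFin-distrib-+ n (λ k → B i k * X k j) (λ k → c * (B i zero * (B zero k * X k j))) ⟩
    (B *ₘ X) i j + sumFin n (λ k → c * (B i zero * (B zero k * X k j)))
      ≈⟨ +-congˡ (*-distribˡ-sumFin n c (λ k → B i zero * (B zero k * X k j))) ⟨
    (B *ₘ X) i j + c * sumFin n (λ k → B i zero * (B zero k * X k j))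
      ≈⟨ +-congˡ (*-congˡ (*-distribˡ-sumFin n (B i zero) (λ k → B zero k * X k j))) ⟨
    (B *ₘ X) i j + c * (B i zero * (B *ₘ X) zero j)
      ∎
    where
    open SetoidReasoning setoid
    n : ℕ
    n = suc m
    rearrange : ∀ y x → c * (B i zero * y) * x ≈ c * (B i zero * (y * x))
    rearrange y x = solve 4 (λ c b y x → (c ⊕ (b ⊕ y)) ⊕ x ⊜ c ⊕ (b ⊕ (y ⊕ x))) refl c (B i zero) y x

  [A-E₁₁]*ₘB : ∀ {m} (A B : Mat (suc m)) → (A *ₘ B) ≈ₘ Iₘ →
               ∀ i j → ((A -ₘ E₁₁) *ₘ B) i j ≈ δ i j - e₀ i * B zero j
  [A-E₁₁]*ₘB A B AB≈I i j = trans (*ₘ-distribʳ-‿ A E₁₁ B i j) (+-cong (AB≈I i j) (-‿cong (E₁₁-*ₘ B i j)))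

  B*ₘ[A-E₁₁] : ∀ {m} (A B : Mat (suc m)) → (B *ₘ A) ≈ₘ Iₘ →
               ∀ i j → (B *ₘ (A -ₘ E₁₁)) i j ≈ δ i j - B i zero * e₀ j
  B*ₘ[A-E₁₁] A B BA≈I i j = trans (*ₘ-distribˡ-‿ B A E₁₁ i j) (+-cong (BA≈I i j) (-‿cong (*ₘ-E₁₁ B i j)))

  A-E₁₁-InGL⇒corner≉1 : ¬ 1# ≈ 0# → ∀ {m} (A B : Mat (suc m)) →
                        (A *ₘ B) ≈ₘ Iₘ → InGL (A -ₘ E₁₁) → ¬ B zero zero ≈ 1#
  A-E₁₁-InGL⇒corner≉1 1≉0 A B AB≈I (Y⁻¹ , _ , Y⁻¹Y≈I) B₀₀≈1 = 1≉0 (trans (sym B₀₀≈1) (B-column≋0 zero))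
    where
    YB-column≋0 : firstColumn ((A -ₘ E₁₁) *ₘ B) ≋ 0ᵥ
    YB-column≋0 i = begin
      ((A -ₘ E₁₁) *ₘ B) i zero  ≈⟨ [A-E₁₁]*ₘB A B AB≈I i zero ⟩
      e₀ i - e₀ i * B zero zero ≈⟨ +-congˡ (-‿cong (trans (*-congˡ B₀₀≈1) (*-identityʳ _))) ⟩
      e₀ i - e₀ i               ≈⟨ -‿inverseʳ _ ⟩
      0#                        ∎
      where open SetoidReasoning setoid
    B-column≋0 : firstColumn B ≋ 0ᵥ
    B-column≋0 i = trans (sym (*ₘ-cancelˡ {X = Y⁻¹} {Y = A -ₘ E₁₁} B Y⁻¹Y≈I i zero)) (*ₘᵥ-zeroʳ Y⁻¹ YB-column≋0 i)

  A-E₁₁-InGL : ∀ {m} (A B : Mat (suc m)) {c} →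
               (A *ₘ B) ≈ₘ Iₘ → (B *ₘ A) ≈ₘ Iₘ → (1# - B zero zero) * c ≈ 1# → InGL (A -ₘ E₁₁)
  A-E₁₁-InGL A B {c} AB≈I BA≈I [1-b]c≈1 = shermanMorrison B c , YZ≈I , ZY≈I
    where
    b : Carrier
    b = B zero zero
    cancelUnit : ∀ x y → c * (x * (1# - b) * y) ≈ x * y
    cancelUnit x y = begin
      c * (x * (1# - b) * y)    ≈⟨ solve 4 (λ c x d y → c ⊕ ((x ⊕ d) ⊕ y) ⊜ (d ⊕ c) ⊕ (x ⊕ y)) refl c x (1# - b) y ⟩
      (1# - b) * c * (x * y)    ≈⟨ *-congʳ [1-b]c≈1 ⟩
      1# * (x * y)              ≈⟨ *-identityˡ _ ⟩
      x * y                     ∎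
      where open SetoidReasoning setoid
    YZ≈I : ((A -ₘ E₁₁) *ₘ shermanMorrison B c) ≈ₘ Iₘ
    YZ≈I i j = begin
      ((A -ₘ E₁₁) *ₘ shermanMorrison B c) i j
        ≈⟨ *ₘ-shermanMorrison (A -ₘ E₁₁) B c i j ⟩
      ((A -ₘ E₁₁) *ₘ B) i j + c * (((A -ₘ E₁₁) *ₘ B) i zero * B zero j)
        ≈⟨ +-cong ([A-E₁₁]*ₘB A B AB≈I i j) (*-congˡ (*-congʳ ([A-E₁₁]*ₘB A B AB≈I i zero))) ⟩
      (δ i j - e₀ i * B zero j) + c * ((e₀ i - e₀ i * b) * B zero j)
        ≈⟨ +-congˡ (*-congˡ (*-congʳ (sym (x[1-b]≈x-xb (e₀ i))))) ⟩
      (δ i j - e₀ i * B zero j) + c * (e₀ i * (1# - b) * B zero j)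
        ≈⟨ +-congˡ (cancelUnit (e₀ i) (B zero j)) ⟩
      (δ i j - e₀ i * B zero j) + e₀ i * B zero j
        ≈⟨ //-rightDividesˡ _ _ ⟩
      δ i j
        ∎
      where
      open SetoidReasoning setoid
      x[1-b]≈x-xb : ∀ x → x * (1# - b) ≈ x - x * b
      x[1-b]≈x-xb x = trans (x[y-z]≈xy-xz x 1# b) (+-congʳ (*-identityʳ x))
    ZY≈I : (shermanMorrison B c *ₘ (A -ₘ E₁₁)) ≈ₘ Iₘ
    ZY≈I i j = begin
      (shermanMorrison B c *ₘ (A -ₘ E₁₁)) i j
        ≈⟨ shermanMorrison-*ₘ B (A -ₘ E₁₁) c i j ⟩
      (B *ₘ (A -ₘ E₁₁)) i j + c * (B i zero * (B *ₘ (A -ₘ E₁₁)) zero j)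
        ≈⟨ +-cong (B*ₘ[A-E₁₁] A B BA≈I i j) (*-congˡ (*-congˡ (B*ₘ[A-E₁₁] A B BA≈I zero j))) ⟩
      (δ i j - B i zero * e₀ j) + c * (B i zero * (δ zero j - b * e₀ j))
        ≈⟨ +-congˡ (*-congˡ (trans (*-congˡ (sym [1-b]e≈e-be)) (sym (*-assoc _ _ _)))) ⟩
      (δ i j - B i zero * e₀ j) + c * (B i zero * (1# - b) * e₀ j)
        ≈⟨ +-congˡ (cancelUnit (B i zero) (e₀ j)) ⟩
      (δ i j - B i zero * e₀ j) + B i zero * e₀ j
        ≈⟨ //-rightDividesˡ _ _ ⟩
      δ i j
        ∎
      where
      open SetoidReasoning setoid
      [1-b]e≈e-be : (1# - b) * e₀ j ≈ δ zero j - b * e₀ j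
      [1-b]e≈e-be = trans ([y-z]x≈yx-zx (e₀ j) 1# b) (+-congʳ (trans (*-identityˡ _) (reflexive (δ-comm j zero))))

  -- The transposition moves a nonzero entry of v to the top, where withFirstColumn becomes invertible.
  nonzero⇒InGL-withFirstColumn : IsField R → Decidable _≈_ → ∀ {m} (v : Vector Carrier (suc m)) → ¬ v ≋ 0ᵥ →
                                 Σ (Mat (suc m)) λ P → InGL P × firstColumn P ≋ v
  nonzero⇒InGL-withFirstColumn isField _≟_ {m} v v≉0 =
    permutationMatrix π *ₘ withFirstColumn u ,
    InGL-*ₘ (permutationMatrix π) (withFirstColumn u) (permutationMatrix-InGL π) (withFirstColumn-InGL u u₀a≈1) ,
    λ i → trans (permutationMatrix-*ₘ π (withFirstColumn u) i zero) (reflexive (≡.cong v (inverseˡ π)))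
    where
    k,vₖ≉0 : Σ (Fin (suc m)) λ k → ¬ v k ≈ 0#
    k,vₖ≉0 = ¬∀⟶∃¬ (suc m) (λ i → v i ≈ 0#) (λ i → v i ≟ 0#) v≉0
    π : Permutation (suc m) (suc m)
    π = transpose (proj₁ k,vₖ≉0) zero
    u : Vector Carrier (suc m)
    u i = v (π ⟨$⟩ˡ i)
    u₀a≈1 : u zero * proj₁ (proj₂ isField (u zero) (proj₂ k,vₖ≉0)) ≈ 1#
    u₀a≈1 = proj₂ (proj₂ isField (u zero) (proj₂ k,vₖ≉0))

  GLcorner≉1 : ℕ → Setoid (c ⊔ ℓ) ℓ
  GLcorner≉1 m = Sub (GL (suc m)) (λ B → ¬ proj₁ B zero zero ≈ 1#)

  E₁₁+GL∩GL↔GLcorner≉1 : IsField R → ∀ m → Inverse (E₁₁+GL∩GL (suc m)) (GLcorner≉1 m)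
  E₁₁+GL∩GL↔GLcorner≉1 isField m = mkInverse to from
    (λ {(A , _ , B , _ , BA≈I)} {(A′ , _ , B′ , A′B′≈I , _)} → inverse-cong A A′ B B′ BA≈I A′B′≈I)
    (λ {((B , A , _ , AB≈I) , _)} {((B′ , A′ , B′A′≈I , _) , _)} → inverse-cong B B′ A A′ AB≈I B′A′≈I)
    (λ _ i j → refl) (λ _ i j → refl)
    where
    to : Setoid.Carrier (E₁₁+GL∩GL (suc m)) → Setoid.Carrier (GLcorner≉1 m)
    to (A , (Y , Y-InGL , A≈E₁₁+Y) , B , AB≈I , BA≈I) =
      (B , A , BA≈I , AB≈I) , A-E₁₁-InGL⇒corner≉1 (proj₁ isField) A B AB≈I (InGL-resp-≈ₘ Y≈A-E₁₁ Y-InGL)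
      where
      Y≈A-E₁₁ : Y ≈ₘ (A -ₘ E₁₁)
      Y≈A-E₁₁ i j = sym (trans (+-congʳ (A≈E₁₁+Y i j)) (xyx⁻¹≈y (E₁₁ i j) (Y i j)))
    from : Setoid.Carrier (GLcorner≉1 m) → Setoid.Carrier (E₁₁+GL∩GL (suc m))
    from ((B , A , BA≈I , AB≈I) , b≉1) =
      A , (A -ₘ E₁₁ , A-E₁₁-InGL A B AB≈I BA≈I [1-b]c≈1 , A≈E₁₁+[A-E₁₁]) , B , AB≈I , BA≈I
      where
      1-b≉0 : ¬ 1# - B zero zero ≈ 0#
      1-b≉0 1-b≈0 = b≉1 (sym (x∙y⁻¹≈ε⇒x≈y 1# (B zero zero) 1-b≈0))
      [1-b]c≈1 : (1# - B zero zero) * proj₁ (proj₂ isField (1# - B zero zero) 1-b≉0) ≈ 1#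
      [1-b]c≈1 = proj₂ (proj₂ isField (1# - B zero zero) 1-b≉0)
      A≈E₁₁+[A-E₁₁] : A ≈ₘ (E₁₁ +ₘ (A -ₘ E₁₁))
      A≈E₁₁+[A-E₁₁] i j = sym (trans (+-comm (E₁₁ i j) _) (//-rightDividesˡ (E₁₁ i j) (A i j)))

module FiniteField {c ℓ} (F : CommutativeRing c ℓ) (isField : IsField F) {q : ℕ} (order : Card (CommutativeRing.setoid F) q) where

  open CommutativeRing F hiding (zero; _*_)
  open MatrixDefs F
  open Matrices F
  open import Data.Vec.Functional.Relation.Binary.Equality.Setoid setoid using (_≋_; ≋-setoid)

  1≉0 : ¬ 1# ≈ 0#
  1≉0 = proj₁ isField

  head∷tail↔ : ∀ {n} → Inverse (≋-setoid (suc n)) (setoid ×ₛ ≋-setoid n)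
  head∷tail↔ = mkInverse (λ v → v zero , v ∘ suc) (λ (x , w) → λ { zero → x ; (suc i) → w i })
    (λ v≋w → v≋w zero , v≋w ∘ suc) (λ { (x≈y , v≋w) zero → x≈y ; (x≈y , v≋w) (suc i) → v≋w i })
    (λ _ → refl , λ _ → refl) (λ _ → λ { zero → refl ; (suc i) → refl })

  head∷tail-Sub↔ : ∀ {n p} (P : Carrier → Set p) →
                   Inverse (Sub (≋-setoid (suc n)) (λ v → P (v zero))) (Sub setoid P ×ₛ ≋-setoid n)
  head∷tail-Sub↔ P = mkInverse
    (λ (v , pv) → (v zero , pv) , v ∘ suc) (λ ((x , px) , w) → (λ { zero → x ; (suc i) → w i }) , px)
    (λ v≋w → v≋w zero , v≋w ∘ suc) (λ { (x≈y , v≋w) zero → x≈y ; (x≈y , v≋w) (suc i) → v≋w i })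
    (λ _ → refl , λ _ → refl) (λ _ → λ { zero → refl ; (suc i) → refl })

  card-vectors : ∀ n → Card (≋-setoid n) (q ^ n)
  card-vectors zero    = card-singleton 0ᵥ (λ _ ())
  card-vectors (suc n) = card-↔ head∷tail↔ (card-× order (card-vectors n))

  NonzeroVectors : ℕ → Setoid (c ⊔ ℓ) ℓ
  NonzeroVectors n = Sub (≋-setoid n) (λ v → ¬ v ≋ 0ᵥ)

  NonzeroHead≉1 : ℕ → Setoid (c ⊔ ℓ) ℓ
  NonzeroHead≉1 m = Sub (Sub (≋-setoid (suc m)) (λ v → ¬ v zero ≈ 1#)) (λ v → ¬ proj₁ v ≋ 0ᵥ)

  card-NonzeroHead≉1 : ∀ m → Card (NonzeroHead≉1 m) ((q ∸ 1) ℕ.* q ^ m ∸ 1)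
  card-NonzeroHead≉1 m =
    card-remove (card-↔ (head∷tail-Sub↔ (λ x → ¬ x ≈ 1#)) (card-× (card-remove order 1#) (card-vectors m))) (0ᵥ , 1≉0 ∘ sym)

  card-GLwithFirstColumn : ∀ {m N} → Card (GL m) N → (v : Vector Carrier (suc m)) → ¬ v ≋ 0ᵥ →
                           Card (GLwithFirstColumn v) (q ^ m ℕ.* N)
  card-GLwithFirstColumn {m} cardGL v v≉0 =
    let (P , P-InGL , P-column≋v) = nonzero⇒InGL-withFirstColumn isField (card⇒decidable order) v v≉0 in
    card-↔ (GLwithFirstColumn-translate {P = P} P-InGL P-column≋v) (card-↔ GLwithFirstColumn-e₀↔ (card-× (card-vectors m) cardGL))

  firstColumnMap : ∀ {m} → Func (GL (suc m)) (NonzeroVectors (suc m))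
  firstColumnMap = record
    { to = λ (A , A-InGL) → firstColumn A , InGL⇒firstColumn≉0 1≉0 A A-InGL
    ; cong = λ A≈B i → A≈B i zero }

  card-GL : ∀ m → Card (GL m) (glOrder q m)
  card-GL zero    = card-singleton (Iₘ , Iₘ , (λ ()) , (λ ())) (λ _ ())
  card-GL (suc m) = ≡.subst (Card (GL (suc m))) (≡.sym (glOrder-suc q m))
    (card-byConstantFibres firstColumnMap (card-remove (card-vectors (suc m)) 0ᵥ)
      (λ (v , v≉0) → card-GLwithFirstColumn (card-GL m) v v≉0))

  firstColumnMap-GLcorner≉1 : ∀ {m} → Func (GLcorner≉1 m) (NonzeroHead≉1 m)
  firstColumnMap-GLcorner≉1 = record
    { to = λ ((A , A-InGL) , A₀₀≉1) → (firstColumn A , A₀₀≉1) , InGL⇒firstColumn≉0 1≉0 A A-InGL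
    ; cong = λ A≈B i → A≈B i zero }

  card-E₁₁+GL∩GL : ∀ m → Card (E₁₁+GL∩GL (suc m)) (((q ∸ 1) ℕ.* q ^ m ∸ 1) ℕ.* (q ^ m ℕ.* glOrder q m))
  card-E₁₁+GL∩GL m = card-↔ (E₁₁+GL∩GL↔GLcorner≉1 isField m)
    (card-byConstantFibres firstColumnMap-GLcorner≉1 (card-NonzeroHead≉1 m) λ ((v , v₀≉1) , v≉0) →
      card-↔ (Sub-restrict (λ column≋v A₀₀≈1 → v₀≉1 (trans (sym (column≋v zero)) A₀₀≈1)))
             (card-GLwithFirstColumn (card-GL m) v v≉0))

open import Data.Nat using (_*_)
open import Data.List using (map; applyUpTo)

mainTheorem5 : ∀ {c ℓ : Level} (F : CommutativeRing c ℓ) → IsField F →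
                 (q : ℕ) → HasOrder F q → (n : ℕ) → n ≥ 1 →
                 HasCard (MatrixDefs.E₁₁+GL∩GL F n)
                   ((q ^ n ∸ q ^ (n ∸ 1) ∸ 1) * product (map (λ k → q ^ n ∸ q ^ k) (applyUpTo suc (n ∸ 1))))
mainTheorem5 F isField q order zero    ()
mainTheorem5 F isField q order (suc m) _ =
  Inverse⇒Bijection (≡.subst (Card (E₁₁+GL∩GL (suc m))) count≡ (card-E₁₁+GL∩GL m))
  where
  open MatrixDefs F using (E₁₁+GL∩GL)
  open FiniteField F isField (Bijection⇒Inverse order) using (card-E₁₁+GL∩GL)
  count≡ : ((q ∸ 1) * q ^ m ∸ 1) * (q ^ m * glOrder q m) ≡
           (q ^ suc m ∸ q ^ m ∸ 1) * product (map (λ k → q ^ suc m ∸ q ^ k) (applyUpTo suc m))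
  count≡ = ≡.cong₂ _*_ (≡.cong (_∸ 1) ([q∸1]*q^m≡q^[1+m]∸q^m q m)) (≡.sym (product-powerDifferences q m))
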